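{- Let $F$ be a field, $A$ a finite-dimensional simple associative $F$-algebra with identity, and $H$ an $F$-subspace of $A$ of codimension one such that $H \cap U(A) = \emptyset$. Then $A \cong F$ and $H = \{0\}$.
   Context: $U(A)$ denotes the set of elements of $A$ having a two-sided multiplicative inverse. -}

module Defs where

open import Level using (Level; _⊔_) renaming (suc to lsuc)
open import Algebra.Bundles using (CommutativeRing; Ring)
open import Data.Nat using (ℕ)
open import Data.Fin using (Fin)
import Data.Fin as Fin
open import Data.Product using (Σ; ∃; _×_; _,_)
open import Data.Sum using (_⊎_)
open import Relation.Nullary using (¬_)
open import Relation.Unary using (Pred)

record Field (c ℓ : Level) : Set (lsuc (c ⊔ ℓ)) where
  field
    commutativeRing : CommutativeRing c ℓ
  open CommutativeRing commutativeRing public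
  field
    1≉0     : ¬ (1# ≈ 0#)
    inverse : ∀ x → ¬ (x ≈ 0#) → ∃ λ y → (x * y) ≈ 1#

record Algebra {c ℓ : Level} (F : Field c ℓ) (a ℓa : Level) : Set (c ⊔ ℓ ⊔ lsuc (a ⊔ ℓa)) where
  private module F = Field F
  field
    ring : Ring a ℓa
  open Ring ring public
  infixr 7 _·_
  field
    _·_        : F.Carrier → Carrier → Carrier
    ·-cong     : ∀ {k l x y} → k F.≈ l → x ≈ y → (k · x) ≈ (l · y)
    ·-distribˡ : ∀ k x y → (k · (x + y)) ≈ ((k · x) + (k · y))
    ·-distribʳ : ∀ k l x → ((k F.+ l) · x) ≈ ((k · x) + (l · x))
    ·-assoc    : ∀ k l x → ((k F.* l) · x) ≈ (k · (l · x))
    ·-identity : ∀ x → (F.1# · x) ≈ x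
    ·-*-assocˡ : ∀ k x y → (k · (x * y)) ≈ ((k · x) * y)
    ·-*-assocʳ : ∀ k x y → (k · (x * y)) ≈ (x * (k · y))

module _ {c ℓ a ℓa : Level} {F : Field c ℓ} (A : Algebra F a ℓa) where
  private module F = Field F
  open Algebra A

  lincomb : ∀ {n} → (Fin n → F.Carrier) → (Fin n → Carrier) → Carrier
  lincomb {ℕ.zero}  cs bs = 0#
  lincomb {ℕ.suc n} cs bs = (cs Fin.zero · bs Fin.zero) + lincomb (λ i → cs (Fin.suc i)) (λ i → bs (Fin.suc i))

  FiniteDimensional : Set (c ⊔ ℓ ⊔ a ⊔ ℓa)
  FiniteDimensional =
    Σ ℕ λ n → Σ (Fin n → Carrier) λ bs →
      (∀ x → Σ (Fin n → F.Carrier) λ cs → x ≈ lincomb cs bs)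
      × (∀ cs → lincomb cs bs ≈ 0# → ∀ i → cs i F.≈ F.0#)

  record IsIdeal {p : Level} (I : Pred Carrier p) : Set (a ⊔ ℓa ⊔ p) where
    field
      resp  : ∀ {x y} → x ≈ y → I x → I y
      zero∈ : I 0#
      +-closed : ∀ {x y} → I x → I y → I (x + y)
      neg-closed : ∀ {x} → I x → I (- x)
      *ˡ-closed : ∀ r {x} → I x → I (r * x)
      *ʳ-closed : ∀ r {x} → I x → I (x * r)

  IsSimple : Set (lsuc (a ⊔ ℓa))
  IsSimple = ¬ (1# ≈ 0#)
    × (∀ (I : Pred Carrier (a ⊔ ℓa)) → IsIdeal I →
         (∀ x → I x → x ≈ 0#) ⊎ (∀ x → I x))

  record IsSubspace {p : Level} (H : Pred Carrier p) : Set (c ⊔ a ⊔ ℓa ⊔ p) where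
    field
      resp  : ∀ {x y} → x ≈ y → H x → H y
      zero∈ : H 0#
      +-closed : ∀ {x y} → H x → H y → H (x + y)
      ·-closed : ∀ k {x} → H x → H (k · x)

  -- codimension one: the quotient space A/H has a basis consisting of one
  -- element, the class of some v : A.
  Codim1 : {p : Level} → Pred Carrier p → Set (c ⊔ ℓ ⊔ a ⊔ p)
  Codim1 H = Σ Carrier λ v →
      (∀ k → H (k · v) → k F.≈ F.0#)
    × (∀ x → Σ F.Carrier λ k → H (x - (k · v)))

  IsUnit : Carrier → Set (a ⊔ ℓa)
  IsUnit x = Σ Carrier λ y → ((x * y) ≈ 1#) × ((y * x) ≈ 1#)

  record IsoToField : Set (c ⊔ ℓ ⊔ a ⊔ ℓa) where
    field
      φ       : Carrier → F.Carrier
      φ-cong  : ∀ {x y} → x ≈ y → φ x F.≈ φ y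
      φ-inj   : ∀ {x y} → φ x F.≈ φ y → x ≈ y
      φ-surj  : ∀ k → Σ Carrier λ x → φ x F.≈ k
      φ-+     : ∀ x y → φ (x + y) F.≈ (φ x F.+ φ y)
      φ-*     : ∀ x y → φ (x * y) F.≈ (φ x F.* φ y)
      φ-1     : φ 1# F.≈ F.1#
      φ-·     : ∀ k x → φ (k · x) F.≈ (k F.* φ x)

{-# OPTIONS --safe #-}

-- Let κ : A → F send x to its coefficient of v modulo H; it is linear with kernel H, so it
-- vanishes on no unit. Then κ kills every nilpotent x, since otherwise 1 - t·x would be a unit
-- in its kernel for a suitable scalar t, and likewise every product x y of square-zero elements,
-- using (1 - x)(1 - t·y). For each x the w with κ (x a w b x) = 0 for all a, b form a two-sided
-- ideal. For an idempotent e and f = 1 - e it contains the products (e a f)(f b e) of square-zero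
-- elements, so by simplicity f = 0 or κ e = 0; a nontrivial idempotent would thus give
-- κ 1 = κ e + κ f = 0. In finite dimension a linear relation among 1, z, …, zⁿ produces the
-- Fitting idempotent (z g)ʲ⁺¹ of z, so every non-unit is nilpotent. For h ∈ H every a h b is
-- then nilpotent, so h lies in the ideal for x = 1, which misses 1 and hence is zero. So H = 0,
-- A = F·1, and x ↦ κ x / κ 1 is an isomorphism A ≅ F.

module Submission where

open import Defs
open import Level using (Level; Lift; lift; _⊔_)
open import Algebra.Bundles using (Ring)
open import Data.Nat using (ℕ; zero; suc; _<_; s≤s)
open import Data.Nat.Properties using (m<n⇒m<1+n; n<1+n)
open import Data.Fin using (Fin; zero; suc; toℕ; punchIn)
open import Data.Fin.Properties using (any?)
open import Data.Vec.Functional using (insertAt; _∷_)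
open import Data.Vec.Functional.Properties using (insertAt-lookup; insertAt-punchIn)
open import Data.Product using (_×_; _,_; ∃; ∃₂; proj₁; proj₂)
open import Data.Sum using (_⊎_; inj₁; inj₂; [_,_]′)
open import Function using (_∘_; id)
open import Data.Empty using (⊥; ⊥-elim)
import Relation.Binary.PropositionalEquality as ≡
open import Relation.Nullary using (¬_; Dec; yes; no; ¬?)
open import Relation.Nullary.Decidable using (decidable-stable; map′)
open import Relation.Unary using (Pred)

module RingTheory {a ℓ} (R : Ring a ℓ) where
  open Ring R hiding (zero)
  open import Algebra.Definitions _≈_ using (_IdempotentOn_)
  open import Algebra.Properties.Ring R
    using (-0#≈0#; -‿involutive; -‿anti-homo-+; x[y-z]≈xy-xz; [y-z]x≈yx-zx; -‿distribˡ-*; -‿distribʳ-*)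
  open import Algebra.Properties.Semiring.Exp semiring using (_^_; ^-congˡ)
  open import Algebra.Solver.CommutativeMonoid +-commutativeMonoid using (solve; _⊕_; _⊜_)
  open import Relation.Binary.Reasoning.Setoid setoid

  Commute : Carrier → Carrier → Set ℓ
  Commute x y = x * y ≈ y * x

  Invertible : Carrier → Set (a ⊔ ℓ)
  Invertible x = ∃ λ y → x * y ≈ 1# × y * x ≈ 1#

  Nilpotent : Carrier → Set ℓ
  Nilpotent x = ∃ λ k → x ^ k ≈ 0#

  y≈0⇒x-y≈x : ∀ {x y} → y ≈ 0# → x - y ≈ x
  y≈0⇒x-y≈x {x} y≈0 = trans (+-congˡ (trans (-‿cong y≈0) -0#≈0#)) (+-identityʳ x)

  [x-y]-[x-z]≈z-y : ∀ x y z → (x - y) - (x - z) ≈ z - y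
  [x-y]-[x-z]≈z-y x y z = begin
    (x - y) - (x - z)         ≈⟨ +-congˡ (-‿anti-homo-+ x (- z)) ⟩
    (x - y) + (- - z + - x)   ≈⟨ +-congˡ (+-congʳ (-‿involutive z)) ⟩
    (x - y) + (z - x)         ≈⟨ solve 4 (λ a b c d → (a ⊕ b) ⊕ (c ⊕ d) ⊜ (c ⊕ b) ⊕ (a ⊕ d)) refl x (- y) z (- x) ⟩
    (z - y) + (x - x)         ≈⟨ +-congˡ (-‿inverseʳ x) ⟩
    (z - y) + 0#              ≈⟨ +-identityʳ _ ⟩
    z - y                     ∎

  [x-y]+[z-w]≈[x+z]-[y+w] : ∀ x y z w → (x - y) + (z - w) ≈ (x + z) - (y + w)
  [x-y]+[z-w]≈[x+z]-[y+w] x y z w = begin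
    (x - y) + (z - w)         ≈⟨ solve 4 (λ a b c d → (a ⊕ b) ⊕ (c ⊕ d) ⊜ (a ⊕ c) ⊕ (d ⊕ b)) refl x (- y) z (- w) ⟩
    (x + z) + (- w + - y)     ≈⟨ +-congˡ (-‿anti-homo-+ y w) ⟨
    (x + z) - (y + w)         ∎

  [1-x][1-y]≈[1+xy]-[x+y] : ∀ x y → (1# - x) * (1# - y) ≈ (1# + x * y) - (x + y)
  [1-x][1-y]≈[1+xy]-[x+y] x y = begin
    (1# - x) * (1# - y)               ≈⟨ [y-z]x≈yx-zx _ 1# x ⟩
    1# * (1# - y) - x * (1# - y)      ≈⟨ +-cong (*-identityˡ _) (-‿cong (x[y-z]≈xy-xz x 1# y)) ⟩
    (1# - y) - (x * 1# - x * y)       ≈⟨ +-congˡ (-‿cong (+-congʳ (*-identityʳ x))) ⟩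
    (1# - y) - (x - x * y)            ≈⟨ +-congˡ (-‿anti-homo-+ x (- (x * y))) ⟩
    (1# - y) + (- - (x * y) + - x)    ≈⟨ +-congˡ (+-congʳ (-‿involutive _)) ⟩
    (1# - y) + (x * y + - x)          ≈⟨ solve 4 (λ a b c d → (a ⊕ b) ⊕ (c ⊕ d) ⊜ (a ⊕ c) ⊕ (d ⊕ b)) refl 1# (- y) (x * y) (- x) ⟩
    (1# + x * y) + (- x + - y)        ≈⟨ +-congˡ (-‿anti-homo-+ y x) ⟨
    (1# + x * y) + - (y + x)          ≈⟨ +-congˡ (-‿cong (+-comm y x)) ⟩
    (1# + x * y) - (x + y)            ∎

  commute-0 : ∀ x → Commute x 0#
  commute-0 x = trans (zeroʳ x) (sym (zeroˡ x))

  commute-1 : ∀ x → Commute x 1#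
  commute-1 x = trans (*-identityʳ x) (sym (*-identityˡ x))

  commute-+ : ∀ {x y z} → Commute x y → Commute x z → Commute x (y + z)
  commute-+ {x} {y} {z} xy≈yx xz≈zx = begin
    x * (y + z)    ≈⟨ distribˡ x y z ⟩
    x * y + x * z  ≈⟨ +-cong xy≈yx xz≈zx ⟩
    y * x + z * x  ≈⟨ distribʳ x y z ⟨
    (y + z) * x    ∎

  commute-neg : ∀ {x y} → Commute x y → Commute x (- y)
  commute-neg {x} {y} xy≈yx = begin
    x * - y    ≈⟨ -‿distribʳ-* x y ⟨
    - (x * y)  ≈⟨ -‿cong xy≈yx ⟩
    - (y * x)  ≈⟨ -‿distribˡ-* y x ⟩
    - y * x    ∎

  commute-* : ∀ {x y z} → Commute x y → Commute x z → Commute x (y * z)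
  commute-* {x} {y} {z} xy≈yx xz≈zx = begin
    x * (y * z)  ≈⟨ *-assoc x y z ⟨
    x * y * z    ≈⟨ *-congʳ xy≈yx ⟩
    y * x * z    ≈⟨ *-assoc y x z ⟩
    y * (x * z)  ≈⟨ *-congˡ xz≈zx ⟩
    y * (z * x)  ≈⟨ *-assoc y z x ⟨
    y * z * x    ∎

  commute-^ : ∀ {x y} n → Commute x y → Commute x (y ^ n)
  commute-^ {x} zero    _     = commute-1 x
  commute-^     (suc n) xy≈yx = commute-* xy≈yx (commute-^ n xy≈yx)

  ^-sucʳ : ∀ x n → x ^ suc n ≈ x ^ n * x
  ^-sucʳ x n = commute-^ n refl

  ^-distrib-* : ∀ {x y} n → Commute x y → (x * y) ^ n ≈ x ^ n * y ^ n
  ^-distrib-* zero    _ = sym (*-identityˡ 1#)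
  ^-distrib-* {x} {y} (suc n) xy≈yx = begin
    x * y * (x * y) ^ n          ≈⟨ *-congˡ (^-distrib-* n xy≈yx) ⟩
    x * y * (x ^ n * y ^ n)      ≈⟨ *-assoc x y _ ⟩
    x * (y * (x ^ n * y ^ n))    ≈⟨ *-congˡ (*-assoc y (x ^ n) (y ^ n)) ⟨
    x * (y * x ^ n * y ^ n)      ≈⟨ *-congˡ (*-congʳ (commute-^ n (sym xy≈yx))) ⟩
    x * (x ^ n * y * y ^ n)      ≈⟨ *-congˡ (*-assoc (x ^ n) y (y ^ n)) ⟩
    x * (x ^ n * (y * y ^ n))    ≈⟨ *-assoc x (x ^ n) _ ⟨
    x * x ^ n * (y * y ^ n)      ∎

  ^-rotate : ∀ x y k → (x * y) ^ suc k ≈ x * ((y * x) ^ k * y)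
  ^-rotate x y zero = begin
    x * y * 1#         ≈⟨ *-identityʳ _ ⟩
    x * y              ≈⟨ *-congˡ (*-identityˡ y) ⟨
    x * (1# * y)       ∎
  ^-rotate x y (suc k) = begin
    x * y * (x * y) ^ suc k                ≈⟨ *-congˡ (^-rotate x y k) ⟩
    x * y * (x * ((y * x) ^ k * y))        ≈⟨ *-assoc x y _ ⟩
    x * (y * (x * ((y * x) ^ k * y)))      ≈⟨ *-congˡ (*-assoc y x _) ⟨
    x * (y * x * ((y * x) ^ k * y))        ≈⟨ *-congˡ (*-assoc (y * x) _ y) ⟨
    x * ((y * x) ^ suc k * y)              ∎

  invertible-* : ∀ {x y} → Invertible x → Invertible y → Invertible (x * y)
  invertible-* {x} {y} (x′ , xx′≈1 , x′x≈1) (y′ , yy′≈1 , y′y≈1) = y′ * x′ , right , left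
    where
    right : x * y * (y′ * x′) ≈ 1#
    right = begin
      x * y * (y′ * x′)    ≈⟨ *-assoc x y _ ⟩
      x * (y * (y′ * x′))  ≈⟨ *-congˡ (*-assoc y y′ x′) ⟨
      x * (y * y′ * x′)    ≈⟨ *-congˡ (*-congʳ yy′≈1) ⟩
      x * (1# * x′)        ≈⟨ *-congˡ (*-identityˡ x′) ⟩
      x * x′               ≈⟨ xx′≈1 ⟩
      1#                   ∎
    left : y′ * x′ * (x * y) ≈ 1#
    left = begin
      y′ * x′ * (x * y)    ≈⟨ *-assoc y′ x′ _ ⟩
      y′ * (x′ * (x * y))  ≈⟨ *-congˡ (*-assoc x′ x y) ⟨
      y′ * (x′ * x * y)    ≈⟨ *-congˡ (*-congʳ x′x≈1) ⟩
      y′ * (1# * y)        ≈⟨ *-congˡ (*-identityˡ y) ⟩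
      y′ * y               ≈⟨ y′y≈1 ⟩
      1#                   ∎

  nilpotent-resp : ∀ {x y} → x ≈ y → Nilpotent x → Nilpotent y
  nilpotent-resp {x} {y} x≈y (k , xᵏ≈0) = k , trans (^-congˡ k (sym x≈y)) xᵏ≈0

  square-zero⇒nilpotent : ∀ {x} → x * x ≈ 0# → Nilpotent x
  square-zero⇒nilpotent {x} x²≈0 = 2 , trans (*-congˡ (*-identityʳ x)) x²≈0

  nilpotent-swap : ∀ {x y} → Nilpotent (y * x) → Nilpotent (x * y)
  nilpotent-swap {x} {y} (k , [yx]ᵏ≈0) = suc k , (begin
    (x * y) ^ suc k        ≈⟨ ^-rotate x y k ⟩
    x * ((y * x) ^ k * y)  ≈⟨ *-congˡ (*-congʳ [yx]ᵏ≈0) ⟩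
    x * (0# * y)           ≈⟨ *-congˡ (zeroˡ y) ⟩
    x * 0#                 ≈⟨ zeroʳ x ⟩
    0#                     ∎)

  left-invertible-nilpotent⇒1≈0 : ∀ {x y} → y * x ≈ 1# → Nilpotent x → 1# ≈ 0#
  left-invertible-nilpotent⇒1≈0 {x} {y} yx≈1 (k , xᵏ≈0) = xᵏ≈0⇒1≈0 k xᵏ≈0
    where
    xᵏ≈0⇒1≈0 : ∀ k → x ^ k ≈ 0# → 1# ≈ 0#
    xᵏ≈0⇒1≈0 zero    1≈0    = 1≈0
    xᵏ≈0⇒1≈0 (suc k) xxᵏ≈0 = xᵏ≈0⇒1≈0 k (begin
      x ^ k            ≈⟨ *-identityˡ _ ⟨
      1# * x ^ k       ≈⟨ *-congʳ yx≈1 ⟨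
      y * x * x ^ k    ≈⟨ *-assoc y x _ ⟩
      y * (x * x ^ k)  ≈⟨ *-congˡ xxᵏ≈0 ⟩
      y * 0#           ≈⟨ zeroʳ y ⟩
      0#               ∎)

  geometric-sum : Carrier → ℕ → Carrier
  geometric-sum x zero    = 0#
  geometric-sum x (suc k) = 1# + x * geometric-sum x k

  geometric-sum-telescopes : ∀ x k → geometric-sum x k * (1# - x) ≈ 1# - x ^ k
  geometric-sum-telescopes x zero = trans (zeroˡ _) (sym (-‿inverseʳ 1#))
  geometric-sum-telescopes x (suc k) = begin
    (1# + x * s) * (1# - x)              ≈⟨ distribʳ _ 1# _ ⟩
    1# * (1# - x) + x * s * (1# - x)     ≈⟨ +-cong (*-identityˡ _) (*-assoc x s _) ⟩
    (1# - x) + x * (s * (1# - x))        ≈⟨ +-congˡ (*-congˡ (geometric-sum-telescopes x k)) ⟩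
    (1# - x) + x * (1# - x ^ k)          ≈⟨ +-congˡ (x[y-z]≈xy-xz x 1# _) ⟩
    (1# - x) + (x * 1# - x ^ suc k)      ≈⟨ +-congˡ (+-congʳ (*-identityʳ x)) ⟩
    (1# + - x) + (x + - x ^ suc k)       ≈⟨ solve 4 (λ a b c d → (a ⊕ b) ⊕ (c ⊕ d) ⊜ (a ⊕ d) ⊕ (c ⊕ b)) refl 1# (- x) x _ ⟩
    (1# - x ^ suc k) + (x - x)           ≈⟨ +-congˡ (-‿inverseʳ x) ⟩
    (1# - x ^ suc k) + 0#                ≈⟨ +-identityʳ _ ⟩
    1# - x ^ suc k                       ∎
    where
    s : Carrier
    s = geometric-sum x k

  commute-geometric-sum : ∀ {x y} k → Commute y x → Commute y (geometric-sum x k)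
  commute-geometric-sum {y = y} zero    _     = commute-0 y
  commute-geometric-sum {y = y} (suc k) yx≈xy =
    commute-+ (commute-1 y) (commute-* yx≈xy (commute-geometric-sum k yx≈xy))

  1-nilpotent-invertible : ∀ {x} → Nilpotent x → Invertible (1# - x)
  1-nilpotent-invertible {x} (k , xᵏ≈0) = s , trans s-commutes inverse , inverse
    where
    s : Carrier
    s = geometric-sum x k
    1-x-commutes-with-x : Commute (1# - x) x
    1-x-commutes-with-x = sym (commute-+ (commute-1 x) (commute-neg refl))
    s-commutes : Commute (1# - x) s
    s-commutes = commute-geometric-sum k 1-x-commutes-with-x
    inverse : s * (1# - x) ≈ 1#
    inverse = begin
      s * (1# - x)  ≈⟨ geometric-sum-telescopes x k ⟩
      1# - x ^ k    ≈⟨ y≈0⇒x-y≈x xᵏ≈0 ⟩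
      1#            ∎

  module Complement {e : Carrier} (e²≈e : _*_ IdempotentOn e) where
    e[1-e]≈0 : e * (1# - e) ≈ 0#
    e[1-e]≈0 = begin
      e * (1# - e)     ≈⟨ x[y-z]≈xy-xz e 1# e ⟩
      e * 1# - e * e   ≈⟨ +-cong (*-identityʳ e) (-‿cong e²≈e) ⟩
      e - e            ≈⟨ -‿inverseʳ e ⟩
      0#               ∎

    [1-e]e≈0 : (1# - e) * e ≈ 0#
    [1-e]e≈0 = begin
      (1# - e) * e     ≈⟨ [y-z]x≈yx-zx e 1# e ⟩
      1# * e - e * e   ≈⟨ +-cong (*-identityˡ e) (-‿cong e²≈e) ⟩
      e - e            ≈⟨ -‿inverseʳ e ⟩
      0#               ∎

    1-e-idempotent : _*_ IdempotentOn (1# - e)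
    1-e-idempotent = begin
      (1# - e) * (1# - e)                 ≈⟨ x[y-z]≈xy-xz (1# - e) 1# e ⟩
      (1# - e) * 1# - (1# - e) * e        ≈⟨ +-cong (*-identityʳ _) (-‿cong [1-e]e≈0) ⟩
      (1# - e) - 0#                       ≈⟨ y≈0⇒x-y≈x refl ⟩
      1# - e                              ∎

    1≈e+[1-e] : 1# ≈ e + (1# - e)
    1≈e+[1-e] = begin
      1#                ≈⟨ +-identityʳ 1# ⟨
      1# + 0#           ≈⟨ +-congˡ (-‿inverseˡ e) ⟨
      1# + (- e + e)    ≈⟨ +-assoc 1# (- e) e ⟨
      (1# - e) + e      ≈⟨ +-comm _ e ⟩
      e + (1# - e)      ∎

  square-zero-sandwich : ∀ {x y} a → y * x ≈ 0# → (x * (a * y)) * (x * (a * y)) ≈ 0#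
  square-zero-sandwich {x} {y} a yx≈0 = begin
    x * (a * y) * (x * (a * y))      ≈⟨ *-assoc x _ _ ⟩
    x * (a * y * (x * (a * y)))      ≈⟨ *-congˡ (*-assoc a y _) ⟩
    x * (a * (y * (x * (a * y))))    ≈⟨ *-congˡ (*-congˡ (*-assoc y x _)) ⟨
    x * (a * (y * x * (a * y)))      ≈⟨ *-congˡ (*-congˡ (*-congʳ yx≈0)) ⟩
    x * (a * (0# * (a * y)))         ≈⟨ *-congˡ (*-congˡ (zeroˡ _)) ⟩
    x * (a * 0#)                     ≈⟨ *-congˡ (zeroʳ a) ⟩
    x * 0#                           ≈⟨ zeroʳ x ⟩
    0#                               ∎

  FittingDatum : Carrier → Set (a ⊔ ℓ)
  FittingDatum z = ∃₂ λ j g → Commute z g × z ^ j ≈ z ^ suc j * g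

  module FittingIdempotent {z g : Carrier} {j : ℕ}
    (zg≈gz : Commute z g) (zʲ≈zʲ⁺¹g : z ^ j ≈ z ^ suc j * g) where

    k : ℕ
    k = suc j

    u : Carrier
    u = z * g

    e : Carrier
    e = u ^ k

    gu≈ug : Commute g u
    gu≈ug = trans (sym (*-assoc g z g)) (*-congʳ (sym zg≈gz))

    zᵏ≈zᵏu : z ^ k ≈ z ^ k * u
    zᵏ≈zᵏu = begin
      z * z ^ j          ≈⟨ *-congˡ zʲ≈zʲ⁺¹g ⟩
      z * (z ^ k * g)    ≈⟨ *-assoc z _ g ⟨
      z * z ^ k * g      ≈⟨ *-congʳ (commute-^ k refl) ⟩
      z ^ k * z * g      ≈⟨ *-assoc _ z g ⟩
      z ^ k * u          ∎

    zᵏ≈zᵏuⁿ : ∀ n → z ^ k ≈ z ^ k * u ^ n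
    zᵏ≈zᵏuⁿ zero    = sym (*-identityʳ _)
    zᵏ≈zᵏuⁿ (suc n) = begin
      z ^ k                  ≈⟨ zᵏ≈zᵏu ⟩
      z ^ k * u              ≈⟨ *-congʳ (zᵏ≈zᵏuⁿ n) ⟩
      z ^ k * u ^ n * u      ≈⟨ *-assoc _ _ u ⟩
      z ^ k * (u ^ n * u)    ≈⟨ *-congˡ (^-sucʳ u n) ⟨
      z ^ k * u ^ suc n      ∎

    e≈zᵏgᵏ : e ≈ z ^ k * g ^ k
    e≈zᵏgᵏ = ^-distrib-* k zg≈gz

    idempotent : _*_ IdempotentOn e
    idempotent = begin
      e * e                  ≈⟨ *-congʳ e≈zᵏgᵏ ⟩
      z ^ k * g ^ k * e      ≈⟨ *-assoc _ _ e ⟩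
      z ^ k * (g ^ k * e)    ≈⟨ *-congˡ (commute-^ k (sym (commute-^ k (sym gu≈ug)))) ⟩
      z ^ k * (e * g ^ k)    ≈⟨ *-assoc _ e _ ⟨
      z ^ k * e * g ^ k      ≈⟨ *-congʳ (zᵏ≈zᵏuⁿ k) ⟨
      z ^ k * g ^ k          ≈⟨ e≈zᵏgᵏ ⟨
      e                      ∎

    e≈0⇒nilpotent : e ≈ 0# → Nilpotent z
    e≈0⇒nilpotent e≈0 = k , trans (zᵏ≈zᵏuⁿ k) (trans (*-congˡ e≈0) (zeroʳ _))

    e≈1⇒invertible : e ≈ 1# → Invertible z
    e≈1⇒invertible e≈1 = g * u ^ j , right , left
      where
      right : z * (g * u ^ j) ≈ 1#
      right = trans (sym (*-assoc z g _)) e≈1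
      left : g * u ^ j * z ≈ 1#
      left = begin
        g * u ^ j * z     ≈⟨ *-congʳ (commute-^ j gu≈ug) ⟩
        u ^ j * g * z     ≈⟨ *-assoc _ g z ⟩
        u ^ j * (g * z)   ≈⟨ *-congˡ (sym zg≈gz) ⟩
        u ^ j * u         ≈⟨ ^-sucʳ u j ⟨
        e                 ≈⟨ e≈1 ⟩
        1#                ∎

module FieldTheory {c ℓ} (F : Field c ℓ) where
  open Field F hiding (zero)
  open import Algebra.Properties.Ring ring using (-‿distribˡ-*; -‿involutive; x[y-z]≈xy-xz; -1*x≈-x)
  open import Algebra.Properties.CommutativeSemigroup *-commutativeSemigroup using (x∙yz≈y∙xz)
  open import Algebra.Properties.Semiring.Sum semiring
    using (sum-syntax; sum-remove; sum-cong-≋; sum-cong-≗; sum-replicate-zero; ∑-distrib-+; *-distribˡ-sum; *-distribʳ-sum)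
  open import Relation.Binary.Reasoning.Setoid setoid

  x*y≈0⇒y≈0 : ∀ {x y} → ¬ x ≈ 0# → x * y ≈ 0# → y ≈ 0#
  x*y≈0⇒y≈0 {x} {y} x≉0 xy≈0 with inverse x x≉0
  ... | x′ , xx′≈1 = begin
    y              ≈⟨ *-identityˡ y ⟨
    1# * y         ≈⟨ *-congʳ (trans (*-comm x′ x) xx′≈1) ⟨
    x′ * x * y     ≈⟨ *-assoc x′ x y ⟩
    x′ * (x * y)   ≈⟨ *-congˡ xy≈0 ⟩
    x′ * 0#        ≈⟨ zeroʳ x′ ⟩
    0#             ∎

  x*y′*y≈x : ∀ {x y y′} → y * y′ ≈ 1# → x * y′ * y ≈ x
  x*y′*y≈x {x} {y} {y′} yy′≈1 = begin
    x * y′ * y     ≈⟨ *-assoc x y′ y ⟩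
    x * (y′ * y)   ≈⟨ *-congˡ (trans (*-comm y′ y) yy′≈1) ⟩
    x * 1#         ≈⟨ *-identityʳ x ⟩
    x              ∎

  x-[-y]*z≈x+y*z : ∀ x y z → x - (- y) * z ≈ x + y * z
  x-[-y]*z≈x+y*z x y z = +-congˡ (trans (-‿cong (sym (-‿distribˡ-* y z))) (-‿involutive (y * z)))

  ∑-zero : ∀ {m} (f : Fin m → Carrier) → (∀ i → f i ≈ 0#) → ∑[ i < m ] f i ≈ 0#
  ∑-zero {m} f f≈0 = trans (sum-cong-≋ f≈0) (sum-replicate-zero m)

  ∑-distrib-sub : ∀ {m} (f g : Fin m → Carrier) → ∑[ i < m ] (f i - g i) ≈ ∑[ i < m ] f i - ∑[ i < m ] g i
  ∑-distrib-sub {m} f g = begin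
    ∑[ i < m ] (f i - g i)                ≈⟨ ∑-distrib-+ f (λ i → - g i) ⟩
    ∑[ i < m ] f i + ∑[ i < m ] (- g i)   ≈⟨ +-congˡ (sum-cong-≋ (λ i → -1*x≈-x (g i))) ⟨
    ∑[ i < m ] f i + ∑[ i < m ] (- 1# * g i) ≈⟨ +-congˡ (*-distribˡ-sum (- 1#) g) ⟨
    ∑[ i < m ] f i + - 1# * ∑[ i < m ] g i ≈⟨ +-congˡ (-1*x≈-x _) ⟩
    ∑[ i < m ] f i - ∑[ i < m ] g i       ∎

  NonTrivial : ∀ {m} → (Fin m → Carrier) → Set ℓ
  NonTrivial cs = ∃ λ i → ¬ cs i ≈ 0#

  Dependent : ∀ {m n} → (Fin m → Fin n → Carrier) → Set (c ⊔ ℓ)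
  Dependent {m} {n} w = ∃ λ cs → NonTrivial cs × ∀ j → ∑[ i < m ] (cs i * w i j) ≈ 0#

  zero-column : ∀ {m n} (w : Fin m → Fin (suc n) → Carrier) → (∀ i → w i zero ≈ 0#) →
                Dependent (λ i j → w i (suc j)) → Dependent w
  zero-column w w≈0 (cs , cs≉0 , cs-eq) = cs , cs≉0 , λ
    { zero    → ∑-zero _ (λ i → trans (*-congˡ (w≈0 i)) (zeroʳ (cs i)))
    ; (suc j) → cs-eq j
    }

  eliminate : ∀ {m n} → Fin (suc m) → (Fin (suc m) → Fin (suc n) → Carrier) → Fin m → Fin n → Carrier
  eliminate p w i j = w p zero * w (punchIn p i) (suc j) - w (punchIn p i) zero * w p (suc j)

  pivot : ∀ {m n} (w : Fin (suc m) → Fin (suc n) → Carrier) p → ¬ w p zero ≈ 0# →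
          Dependent (eliminate p w) → Dependent w
  pivot {m} {n} w p α≉0 (d , (i₀ , dᵢ₀≉0) , d-eq) = cs , (punchIn p i₀ , csᵢ₀≉0) , cs-eq
    where
    α : Carrier
    α = w p zero
    T : Fin (suc n) → Carrier
    T j = ∑[ i < m ] (d i * w (punchIn p i) j)
    cs : Fin (suc m) → Carrier
    cs = insertAt (λ i → α * d i) p (- T zero)

    csᵢ₀≉0 : ¬ cs (punchIn p i₀) ≈ 0#
    csᵢ₀≉0 csᵢ₀≈0 =
      dᵢ₀≉0 (x*y≈0⇒y≈0 α≉0 (trans (reflexive (≡.sym (insertAt-punchIn _ p _ i₀))) csᵢ₀≈0))

    column : ∀ j → ∑[ i < suc m ] (cs i * w i j) ≈ α * T j - T zero * w p j
    column j = begin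
      ∑[ i < suc m ] (cs i * w i j)                                     ≈⟨ sum-remove {i = p} (λ i → cs i * w i j) ⟩
      cs p * w p j + ∑[ i < m ] (cs (punchIn p i) * w (punchIn p i) j)  ≡⟨ ≡.cong₂ (λ x y → x * w p j + y)
                                                                             (insertAt-lookup _ p _)
                                                                             (sum-cong-≗ (λ i → ≡.cong (_* w (punchIn p i) j) (insertAt-punchIn _ p _ i))) ⟩
      - T zero * w p j + ∑[ i < m ] (α * d i * w (punchIn p i) j)       ≈⟨ +-congˡ (sum-cong-≋ (λ i → *-assoc α (d i) _)) ⟩
      - T zero * w p j + ∑[ i < m ] (α * (d i * w (punchIn p i) j))     ≈⟨ +-congˡ (*-distribˡ-sum α (λ i → d i * w (punchIn p i) j)) ⟨
      - T zero * w p j + α * T j                                        ≈⟨ +-comm _ _ ⟩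
      α * T j + - T zero * w p j                                        ≈⟨ +-congˡ (-‿distribˡ-* _ _) ⟨
      α * T j - T zero * w p j                                          ∎

    eliminated-column : ∀ j → ∑[ i < m ] (d i * eliminate p w i j) ≈ α * T (suc j) - T zero * w p (suc j)
    eliminated-column j = begin
      ∑[ i < m ] (d i * (α * r i - s i * q))            ≈⟨ sum-cong-≋ (λ i → x[y-z]≈xy-xz (d i) _ _) ⟩
      ∑[ i < m ] (d i * (α * r i) - d i * (s i * q))    ≈⟨ sum-cong-≋ (λ i → +-cong (x∙yz≈y∙xz (d i) α _) (-‿cong (sym (*-assoc (d i) _ q)))) ⟩
      ∑[ i < m ] (α * (d i * r i) - d i * s i * q)      ≈⟨ ∑-distrib-sub (λ i → α * (d i * r i)) (λ i → d i * s i * q) ⟩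
      ∑[ i < m ] (α * (d i * r i)) - ∑[ i < m ] (d i * s i * q)
                                                        ≈⟨ +-cong (*-distribˡ-sum α (λ i → d i * r i)) (-‿cong (*-distribʳ-sum q (λ i → d i * s i))) ⟨
      α * T (suc j) - T zero * q                        ∎
      where
      r s : Fin m → Carrier
      r i = w (punchIn p i) (suc j)
      s i = w (punchIn p i) zero
      q : Carrier
      q = w p (suc j)

    cs-eq : ∀ j → ∑[ i < suc m ] (cs i * w i j) ≈ 0#
    cs-eq zero    = trans (column zero) (trans (+-congʳ (*-comm α _)) (-‿inverseʳ _))
    cs-eq (suc j) = trans (column (suc j)) (trans (sym (eliminated-column j)) (d-eq j))

  module GaussianElimination (_≟0 : ∀ k → Dec (k ≈ 0#)) where
    dependent : ∀ {m n} → n < m → (w : Fin m → Fin n → Carrier) → Dependent w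
    dependent {suc m} {zero}  _         w = (λ _ → 1#) , (zero , 1≉0) , λ ()
    dependent {suc m} {suc n} (s≤s n<m) w with any? (λ i → ¬? (w i zero ≟0))
    ... | yes (p , α≉0) = pivot w p α≉0 (dependent n<m (eliminate p w))
    ... | no  no-pivot  = zero-column w (λ i → decidable-stable (w i zero ≟0) (λ w≉0 → no-pivot (i , w≉0)))
                              (dependent (m<n⇒m<1+n n<m) (λ i j → w i (suc j)))

module AlgebraTheory {c ℓ a ℓa} {F : Field c ℓ} (A : Algebra F a ℓa) where
  private module F = Field F
  open Algebra A hiding (zero)
  open RingTheory ring public
  open FieldTheory F using (NonTrivial; x*y′*y≈x; x-[-y]*z≈x+y*z; module GaussianElimination)
  open RingTheory F.ring using () renaming (y≈0⇒x-y≈x to y≈0⇒x-y≈xᶠ)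
  open import Algebra.Properties.Ring F.ring using (-1*x≈-x) renaming (-‿distribˡ-* to -‿distribˡ-*ᶠ; -0#≈0# to -0≈0ᶠ; x∙y⁻¹≈ε⇒x≈y to x∙y⁻¹≈ε⇒x≈yᶠ)
  open import Algebra.Properties.Ring ring using (-0#≈0#; x+x≈x⇒x≈0; x∙y⁻¹≈ε⇒x≈y; +-inverseˡ-unique; +-inverseʳ-unique; -‿distribˡ-*; -‿distribʳ-*)
  open import Algebra.Solver.CommutativeMonoid +-commutativeMonoid using (solve; _⊕_; _⊜_)
  open import Algebra.Properties.Semiring.Exp semiring using (_^_)
  open import Algebra.Properties.Semiring.Exp F.semiring using () renaming (_^_ to _^ᶠ_)
  open import Algebra.Properties.Semiring.Sum F.semiring using (sum-syntax)
  open import Algebra.Definitions _≈_ using (_IdempotentOn_)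
  open import Relation.Binary.Reasoning.Setoid setoid

  ·-zeroˡ : ∀ x → F.0# · x ≈ 0#
  ·-zeroˡ x = x+x≈x⇒x≈0 _ (trans (sym (·-distribʳ F.0# F.0# x)) (·-cong (F.+-identityʳ F.0#) refl))

  ·-zeroʳ : ∀ k → k · 0# ≈ 0#
  ·-zeroʳ k = x+x≈x⇒x≈0 _ (trans (sym (·-distribˡ k 0# 0#)) (·-cong F.refl (+-identityʳ 0#)))

  ·-negˡ : ∀ k x → (F.- k) · x ≈ - (k · x)
  ·-negˡ k x = +-inverseʳ-unique (k · x) _ (begin
    k · x + (F.- k) · x   ≈⟨ ·-distribʳ k (F.- k) x ⟨
    (k F.+ F.- k) · x     ≈⟨ ·-cong (F.-‿inverseʳ k) refl ⟩
    F.0# · x              ≈⟨ ·-zeroˡ x ⟩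
    0#                    ∎)

  ·-negʳ : ∀ k x → k · (- x) ≈ - (k · x)
  ·-negʳ k x = +-inverseʳ-unique (k · x) _ (begin
    k · x + k · (- x)     ≈⟨ ·-distribˡ k x (- x) ⟨
    k · (x - x)           ≈⟨ ·-cong F.refl (-‿inverseʳ x) ⟩
    k · 0#                ≈⟨ ·-zeroʳ k ⟩
    0#                    ∎)

  ·1-* : ∀ k l → (k · 1#) * (l · 1#) ≈ (k F.* l) · 1#
  ·1-* k l = begin
    (k · 1#) * (l · 1#)   ≈⟨ ·-*-assocˡ k 1# (l · 1#) ⟨
    k · (1# * (l · 1#))   ≈⟨ ·-cong F.refl (*-identityˡ _) ⟩
    k · (l · 1#)          ≈⟨ ·-assoc k l 1# ⟨
    (k F.* l) · 1#        ∎

  commute-· : ∀ {x y} k → Commute x y → Commute x (k · y)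
  commute-· {x} {y} k xy≈yx = begin
    x * (k · y)   ≈⟨ ·-*-assocʳ k x y ⟨
    k · (x * y)   ≈⟨ ·-cong F.refl xy≈yx ⟩
    k · (y * x)   ≈⟨ ·-*-assocˡ k y x ⟩
    (k · y) * x   ∎

  ·-^ : ∀ k x n → (k · x) ^ n ≈ (k ^ᶠ n) · x ^ n
  ·-^ k x zero    = sym (·-identity 1#)
  ·-^ k x (suc n) = begin
    (k · x) * (k · x) ^ n            ≈⟨ *-congˡ (·-^ k x n) ⟩
    (k · x) * ((k ^ᶠ n) · x ^ n)     ≈⟨ ·-*-assocˡ k x _ ⟨
    k · (x * ((k ^ᶠ n) · x ^ n))     ≈⟨ ·-cong F.refl (·-*-assocʳ (k ^ᶠ n) x _) ⟨
    k · ((k ^ᶠ n) · (x * x ^ n))     ≈⟨ ·-assoc k (k ^ᶠ n) _ ⟨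
    (k ^ᶠ suc n) · x ^ suc n         ∎

  nilpotent-· : ∀ k {x} → Nilpotent x → Nilpotent (k · x)
  nilpotent-· k {x} (n , xⁿ≈0) = n , trans (·-^ k x n) (trans (·-cong F.refl xⁿ≈0) (·-zeroʳ _))

  lincomb-trivial : ∀ {m} {cs : Fin m → F.Carrier} (bs : Fin m → Carrier) →
                    (∀ i → cs i F.≈ F.0#) → lincomb A cs bs ≈ 0#
  lincomb-trivial {zero}  bs _     = refl
  lincomb-trivial {suc m} bs cs≈0 = begin
    _ · bs zero + lincomb A _ (λ i → bs (suc i))  ≈⟨ +-cong (trans (·-cong (cs≈0 zero) refl) (·-zeroˡ _))
                                                           (lincomb-trivial (λ i → bs (suc i)) (λ i → cs≈0 (suc i))) ⟩
    0# + 0#                                        ≈⟨ +-identityʳ 0# ⟩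
    0#                                             ∎

  lincomb-congʳ : ∀ {m} (cs : Fin m → F.Carrier) {bs bs′ : Fin m → Carrier} →
                  (∀ i → bs i ≈ bs′ i) → lincomb A cs bs ≈ lincomb A cs bs′
  lincomb-congʳ {zero}  cs _      = refl
  lincomb-congʳ {suc m} cs bs≈bs′ =
    +-cong (·-cong F.refl (bs≈bs′ zero)) (lincomb-congʳ (λ i → cs (suc i)) (λ i → bs≈bs′ (suc i)))

  lincomb-+ : ∀ {m} (cs ds : Fin m → F.Carrier) bs →
              lincomb A cs bs + lincomb A ds bs ≈ lincomb A (λ i → cs i F.+ ds i) bs
  lincomb-+ {zero}  _  _  _  = +-identityʳ 0#
  lincomb-+ {suc m} cs ds bs = begin
    (c₀ · b₀ + C) + (d₀ · b₀ + D)   ≈⟨ solve 4 (λ a b c d → (a ⊕ b) ⊕ (c ⊕ d) ⊜ (a ⊕ c) ⊕ (b ⊕ d)) refl (c₀ · b₀) C (d₀ · b₀) D ⟩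
    (c₀ · b₀ + d₀ · b₀) + (C + D)   ≈⟨ +-cong (sym (·-distribʳ c₀ d₀ b₀)) (lincomb-+ (λ i → cs (suc i)) (λ i → ds (suc i)) (λ i → bs (suc i))) ⟩
    (c₀ F.+ d₀) · b₀ + _            ∎
    where
    c₀ d₀ : F.Carrier
    c₀ = cs zero
    d₀ = ds zero
    b₀ : Carrier
    b₀ = bs zero
    C D : Carrier
    C = lincomb A (λ i → cs (suc i)) (λ i → bs (suc i))
    D = lincomb A (λ i → ds (suc i)) (λ i → bs (suc i))

  lincomb-· : ∀ {m} k (cs : Fin m → F.Carrier) bs → k · lincomb A cs bs ≈ lincomb A (λ i → k F.* cs i) bs
  lincomb-· {zero}  k _  _  = ·-zeroʳ k
  lincomb-· {suc m} k cs bs = trans (·-distribˡ k _ _)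
    (+-cong (sym (·-assoc k (cs zero) (bs zero))) (lincomb-· k (λ i → cs (suc i)) (λ i → bs (suc i))))

  lincomb-swap : ∀ {m n} (cs : Fin m → F.Carrier) (w : Fin m → Fin n → F.Carrier) bs →
                 lincomb A cs (λ i → lincomb A (w i) bs) ≈ lincomb A (λ j → ∑[ i < m ] (cs i F.* w i j)) bs
  lincomb-swap {zero}  _  _ bs = sym (lincomb-trivial bs (λ _ → F.refl))
  lincomb-swap {suc m} cs w bs = trans
    (+-cong (lincomb-· (cs zero) (w zero) bs) (lincomb-swap (λ i → cs (suc i)) (λ i → w (suc i)) bs))
    (lincomb-+ _ _ bs)

  lincomb-*ˡ : ∀ {m} (cs : Fin m → F.Carrier) y bs → lincomb A cs (λ i → y * bs i) ≈ y * lincomb A cs bs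
  lincomb-*ˡ {zero}  _  y _  = sym (zeroʳ y)
  lincomb-*ˡ {suc m} cs y bs = trans
    (+-cong (·-*-assocʳ (cs zero) y (bs zero)) (lincomb-*ˡ (λ i → cs (suc i)) y (λ i → bs (suc i))))
    (sym (distribˡ y _ _))

  commute-lincomb : ∀ {m z} (cs : Fin m → F.Carrier) {bs} → (∀ i → Commute z (bs i)) → Commute z (lincomb A cs bs)
  commute-lincomb {zero}  {z} _  _         = commute-0 z
  commute-lincomb {suc m}     cs z-commutes =
    commute-+ (commute-· (cs zero) (z-commutes zero)) (commute-lincomb (λ i → cs (suc i)) (λ i → z-commutes (suc i)))

  polynomial : ∀ {m} → (Fin m → F.Carrier) → Carrier → Carrier
  polynomial cs z = lincomb A cs (λ i → z ^ toℕ i)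

  commute-polynomial : ∀ {m z} (cs : Fin m → F.Carrier) → Commute z (polynomial cs z)
  commute-polynomial cs = commute-lincomb cs (λ i → commute-^ (toℕ i) refl)

  ^-*-polynomial : ∀ {m} z j (cs : Fin (suc m) → F.Carrier) →
                   z ^ j * polynomial cs z ≈ cs zero · z ^ j + z ^ suc j * polynomial (λ i → cs (suc i)) z
  ^-*-polynomial {m} z j cs = begin
    z ^ j * (c₀ · 1# + lincomb A cs′ (λ i → z * z ^ toℕ i)) ≈⟨ *-congˡ (+-congˡ (lincomb-*ˡ cs′ z (λ i → z ^ toℕ i))) ⟩
    z ^ j * (c₀ · 1# + z * q)                              ≈⟨ distribˡ _ _ _ ⟩
    z ^ j * (c₀ · 1#) + z ^ j * (z * q)                    ≈⟨ +-cong (·-*-assocʳ c₀ _ 1#) (*-assoc _ z q) ⟨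
    c₀ · (z ^ j * 1#) + z ^ j * z * q                      ≈⟨ +-cong (·-cong F.refl (*-identityʳ _)) (*-congʳ (sym (^-sucʳ z j))) ⟩
    c₀ · z ^ j + z ^ suc j * q                             ∎
    where
    c₀ : F.Carrier
    c₀ = cs zero
    cs′ : Fin m → F.Carrier
    cs′ i = cs (suc i)
    q : Carrier
    q = polynomial cs′ z

  zero-or : Set ℓa → Pred Carrier (a ⊔ ℓa)
  zero-or Q x = x ≈ 0# ⊎ Lift a Q

  zero-or-ideal : ∀ Q → IsIdeal A (zero-or Q)
  zero-or-ideal Q = record
    { resp       = λ { x≈y (inj₁ x≈0) → inj₁ (trans (sym x≈y) x≈0) ; _ (inj₂ q) → inj₂ q }
    ; zero∈      = inj₁ refl
    ; +-closed   = λ { (inj₁ x≈0) (inj₁ y≈0) → inj₁ (trans (+-cong x≈0 y≈0) (+-identityʳ 0#))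
                     ; (inj₁ _) (inj₂ q) → inj₂ q
                     ; (inj₂ q) _ → inj₂ q }
    ; neg-closed = λ { (inj₁ x≈0) → inj₁ (trans (-‿cong x≈0) -0#≈0#) ; (inj₂ q) → inj₂ q }
    ; *ˡ-closed  = λ { r (inj₁ x≈0) → inj₁ (trans (*-congˡ x≈0) (zeroʳ r)) ; _ (inj₂ q) → inj₂ q }
    ; *ʳ-closed  = λ { r (inj₁ x≈0) → inj₁ (trans (*-congʳ x≈0) (zeroˡ r)) ; _ (inj₂ q) → inj₂ q }
    }

  -- Read constructively, simplicity decides every proposition Q: the ideal zero-or Q is either
  -- zero, refuting Q, or all of A, and then 1# ∈ zero-or Q proves Q.
  simple⇒decidable : IsSimple A → (Q : Set ℓa) → Dec Q
  simple⇒decidable (1≉0 , trivial-ideals) Q with trivial-ideals (zero-or Q) (zero-or-ideal Q)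
  ... | inj₁ only-0 = no (λ q → 1≉0 (only-0 1# (inj₂ (lift q))))
  ... | inj₂ all    with all 1#
  ...   | inj₁ 1≈0      = ⊥-elim (1≉0 1≈0)
  ...   | inj₂ (lift q) = yes q

  -- k ≈ 0 is decided through k · b₀ ≈ 0 for a basis vector b₀, a proposition about A.
  ≈0-decidable : IsSimple A → FiniteDimensional A → ∀ k → Dec (k F.≈ F.0#)
  ≈0-decidable (1≉0 , _) (zero , _ , spans , _) k = ⊥-elim (1≉0 (proj₂ (spans 1#)))
  ≈0-decidable simple (suc n , bs , _ , independent) k =
    map′ (λ k·b₀≈0 → independent (k ∷ λ _ → F.0#) (k·b₀+0≈0 k·b₀≈0) zero)
         (λ k≈0 → trans (·-cong k≈0 refl) (·-zeroˡ (bs zero)))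
         (simple⇒decidable simple (k · bs zero ≈ 0#))
    where
    k·b₀+0≈0 : k · bs zero ≈ 0# → k · bs zero + lincomb A (λ _ → F.0#) (λ i → bs (suc i)) ≈ 0#
    k·b₀+0≈0 k·b₀≈0 = trans (+-cong k·b₀≈0 (lincomb-trivial (λ i → bs (suc i)) (λ _ → F.refl))) (+-identityʳ 0#)

  module DecidableScalars (_≟0 : ∀ k → Dec (k F.≈ F.0#)) where
    open GaussianElimination _≟0

    k·1≈0⇒k≈0 : ¬ 1# ≈ 0# → ∀ {k} → k · 1# ≈ 0# → k F.≈ F.0#
    k·1≈0⇒k≈0 1≉0 {k} k·1≈0 with k ≟0
    ... | yes k≈0 = k≈0
    ... | no  k≉0 with F.inverse k k≉0
    ...   | k′ , kk′≈1 = ⊥-elim (1≉0 (begin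
      1#                ≈⟨ ·-identity 1# ⟨
      F.1# · 1#         ≈⟨ ·-cong (F.trans (F.*-comm k′ k) kk′≈1) refl ⟨
      (k′ F.* k) · 1#   ≈⟨ ·-assoc k′ k 1# ⟩
      k′ · (k · 1#)     ≈⟨ ·-cong F.refl k·1≈0 ⟩
      k′ · 0#           ≈⟨ ·-zeroʳ k′ ⟩
      0#                ∎))

    spanned⇒dependent : ∀ {m n} → n < m → (bs : Fin n → Carrier) (xs : Fin m → Carrier) →
                        (∀ i → ∃ λ cs → xs i ≈ lincomb A cs bs) →
                        ∃ λ cs → NonTrivial cs × lincomb A cs xs ≈ 0#
    spanned⇒dependent n<m bs xs coordinates with dependent n<m (λ i → proj₁ (coordinates i))
    ... | cs , cs≉0 , cs-eq = cs , cs≉0 , (begin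
      lincomb A cs xs                                          ≈⟨ lincomb-congʳ cs (λ i → proj₂ (coordinates i)) ⟩
      lincomb A cs (λ i → lincomb A (proj₁ (coordinates i)) bs) ≈⟨ lincomb-swap cs _ bs ⟩
      lincomb A _ bs                                           ≈⟨ lincomb-trivial bs cs-eq ⟩
      0#                                                       ∎)

    annihilating-polynomial⇒fitting-datum : ∀ {m} z j (cs : Fin m → F.Carrier) → NonTrivial cs →
                                            z ^ j * polynomial cs z ≈ 0# → FittingDatum z
    annihilating-polynomial⇒fitting-datum {suc m} z j cs (i , csᵢ≉0) zʲp≈0 with cs zero ≟0
    ... | yes c₀≈0 = annihilating-polynomial⇒fitting-datum z (suc j) (λ i → cs (suc i)) (nonzero-in-tail i csᵢ≉0) (begin
      z ^ suc j * q                    ≈⟨ +-identityˡ _ ⟨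
      0# + z ^ suc j * q               ≈⟨ +-congʳ (trans (·-cong c₀≈0 refl) (·-zeroˡ _)) ⟨
      cs zero · z ^ j + z ^ suc j * q  ≈⟨ ^-*-polynomial z j cs ⟨
      z ^ j * polynomial cs z          ≈⟨ zʲp≈0 ⟩
      0#                               ∎)
      where
      q : Carrier
      q = polynomial (λ i → cs (suc i)) z
      nonzero-in-tail : ∀ i → ¬ cs i F.≈ F.0# → NonTrivial (λ i → cs (suc i))
      nonzero-in-tail zero    c₀≉0  = ⊥-elim (c₀≉0 c₀≈0)
      nonzero-in-tail (suc i) csᵢ≉0 = i , csᵢ≉0
    ... | no c₀≉0 with F.inverse (cs zero) c₀≉0
    ...   | c₀′ , c₀c₀′≈1 = j , - (c₀′ · q) , commute-neg (commute-· c₀′ (commute-polynomial (λ i → cs (suc i)))) , (begin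
      z ^ j                               ≈⟨ ·-identity _ ⟨
      F.1# · z ^ j                        ≈⟨ ·-cong (F.trans (F.*-comm c₀′ (cs zero)) c₀c₀′≈1) refl ⟨
      (c₀′ F.* cs zero) · z ^ j           ≈⟨ ·-assoc c₀′ (cs zero) _ ⟩
      c₀′ · (cs zero · z ^ j)             ≈⟨ ·-cong F.refl (+-inverseˡ-unique _ _ (trans (sym (^-*-polynomial z j cs)) zʲp≈0)) ⟩
      c₀′ · - (z ^ suc j * q)             ≈⟨ ·-negʳ c₀′ _ ⟩
      - (c₀′ · (z ^ suc j * q))           ≈⟨ -‿cong (·-*-assocʳ c₀′ _ q) ⟩
      - (z ^ suc j * (c₀′ · q))           ≈⟨ -‿distribʳ-* _ _ ⟩
      z ^ suc j * - (c₀′ · q)             ∎)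
      where
      q : Carrier
      q = polynomial (λ i → cs (suc i)) z

    fitting-datum : FiniteDimensional A → ∀ z → FittingDatum z
    fitting-datum (n , bs , spans , _) z
      with spanned⇒dependent (n<1+n n) bs (λ i → z ^ toℕ i) (λ i → spans (z ^ toℕ i))
    ... | cs , cs≉0 , p[z]≈0 = annihilating-polynomial⇒fitting-datum z 0 cs cs≉0 (trans (*-identityˡ _) p[z]≈0)

  module LinearFunctional (κ : Carrier → F.Carrier) (κ-cong : ∀ {x y} → x ≈ y → κ x F.≈ κ y)
    (κ-+ : ∀ x y → κ (x + y) F.≈ κ x F.+ κ y) (κ-· : ∀ k x → κ (k · x) F.≈ k F.* κ x) where

    κ-0 : κ 0# F.≈ F.0#
    κ-0 = F.trans (κ-cong (sym (·-zeroˡ 0#))) (F.trans (κ-· F.0# 0#) (F.zeroˡ _))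

    κ-neg : ∀ x → κ (- x) F.≈ F.- κ x
    κ-neg x = F.trans (κ-cong (trans (-‿cong (sym (·-identity x))) (sym (·-negˡ F.1# x))))
                      (F.trans (κ-· (F.- F.1#) x) (-1*x≈-x (κ x)))

    κ-sub : ∀ x y → κ (x - y) F.≈ κ x F.- κ y
    κ-sub x y = F.trans (κ-+ x (- y)) (F.+-congˡ (κ-neg y))

    module TrivialKernel (κ≈0⇒≈0 : ∀ {x} → κ x F.≈ F.0# → x ≈ 0#) (κ1≉0 : ¬ κ 1# F.≈ F.0#) where
      ι : F.Carrier
      ι = proj₁ (F.inverse (κ 1#) κ1≉0)

      κ1ι≈1 : κ 1# F.* ι F.≈ F.1#
      κ1ι≈1 = proj₂ (F.inverse (κ 1#) κ1≉0)

      φ : Carrier → F.Carrier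
      φ x = κ x F.* ι

      φ-· : ∀ k x → φ (k · x) F.≈ k F.* φ x
      φ-· k x = F.trans (F.*-congʳ (κ-· k x)) (F.*-assoc k (κ x) ι)

      φ-·1 : ∀ k → φ (k · 1#) F.≈ k
      φ-·1 k = F.trans (φ-· k 1#) (F.trans (F.*-congˡ κ1ι≈1) (F.*-identityʳ k))

      ≈φ·1 : ∀ x → x ≈ φ x · 1#
      ≈φ·1 x = x∙y⁻¹≈ε⇒x≈y x _ (κ≈0⇒≈0 (F.trans (κ-sub x _)
                 (F.trans (F.+-congˡ (F.-‿cong (F.trans (κ-· (φ x) 1#) (x*y′*y≈x κ1ι≈1)))) (F.-‿inverseʳ (κ x)))))

      isoToField : IsoToField A
      isoToField = record
        { φ      = φ
        ; φ-cong = λ x≈y → F.*-congʳ (κ-cong x≈y)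
        ; φ-inj  = λ {x} {y} φx≈φy → trans (≈φ·1 x) (trans (·-cong φx≈φy refl) (sym (≈φ·1 y)))
        ; φ-surj = λ k → k · 1# , φ-·1 k
        ; φ-+    = λ x y → F.trans (F.*-congʳ (κ-+ x y)) (F.distribʳ ι (κ x) (κ y))
        ; φ-*    = λ x y → F.trans (F.*-congʳ (κ-cong (trans (*-cong (≈φ·1 x) (≈φ·1 y)) (·1-* (φ x) (φ y)))))
                                   (φ-·1 (φ x F.* φ y))
        ; φ-1    = κ1ι≈1
        ; φ-·    = φ-·
        }

    module UnitDetecting (simple : IsSimple A) (fd : FiniteDimensional A)
      (κ-unit : ∀ {u} → IsUnit A u → ¬ κ u F.≈ F.0#) where
      _≟0 : ∀ k → Dec (k F.≈ F.0#)
      _≟0 = ≈0-decidable simple fd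

      open DecidableScalars _≟0

      1≉0 : ¬ 1# ≈ 0#
      1≉0 = proj₁ simple

      κ1≉0 : ¬ κ 1# F.≈ F.0#
      κ1≉0 = κ-unit (1# , *-identityˡ 1# , *-identityˡ 1#)

      -- If κ y ≉ 0, the t with κ 1# + t * κ y ≈ 0 puts the unit u t into the kernel of κ.
      unit-line⇒κ≈0 : ∀ {y} (u : F.Carrier → Carrier) → (∀ t → IsUnit A (u t)) →
                      (∀ t → κ (u t) F.≈ κ 1# F.+ t F.* κ y) → κ y F.≈ F.0#
      unit-line⇒κ≈0 {y} u u-unit κu with κ y ≟0
      ... | yes κy≈0 = κy≈0
      ... | no  κy≉0 with F.inverse (κ y) κy≉0
      ...   | ι , κyι≈1 = ⊥-elim (κ-unit (u-unit t) (F.trans (κu t)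
              (F.trans (F.+-congˡ (F.trans (F.sym (-‿distribˡ-*ᶠ _ (κ y))) (F.-‿cong (x*y′*y≈x κyι≈1))))
                       (F.-‿inverseʳ (κ 1#)))))
        where
        t : F.Carrier
        t = F.- (κ 1# F.* ι)

      κ-nilpotent : ∀ {x} → Nilpotent x → κ x F.≈ F.0#
      κ-nilpotent {x} x-nilpotent = unit-line⇒κ≈0 (λ t → 1# - (F.- t) · x)
        (λ t → 1-nilpotent-invertible (nilpotent-· (F.- t) x-nilpotent))
        (λ t → F.trans (κ-sub 1# _) (F.trans (F.+-congˡ (F.-‿cong (κ-· (F.- t) x))) (x-[-y]*z≈x+y*z _ t _)))

      κ-square-zero-product : ∀ {x y} → x * x ≈ 0# → y * y ≈ 0# → κ (x * y) F.≈ F.0#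
      κ-square-zero-product {x} {y} x²≈0 y²≈0 = unit-line⇒κ≈0 (λ t → (1# - x) * (1# - t · y))
        (λ t → invertible-* (1-nilpotent-invertible (square-zero⇒nilpotent x²≈0))
                            (1-nilpotent-invertible (nilpotent-· t (square-zero⇒nilpotent y²≈0))))
        κ-line
        where
        κx≈0 : κ x F.≈ F.0#
        κx≈0 = κ-nilpotent (square-zero⇒nilpotent x²≈0)
        κy≈0 : κ y F.≈ F.0#
        κy≈0 = κ-nilpotent (square-zero⇒nilpotent y²≈0)
        κ-line : ∀ t → κ ((1# - x) * (1# - t · y)) F.≈ κ 1# F.+ t F.* κ (x * y)
        κ-line t = F.trans (κ-cong ([1-x][1-y]≈[1+xy]-[x+y] x (t · y)))
                  (F.trans (κ-sub _ _)
                  (F.trans (y≈0⇒x-y≈xᶠ κ[x+ty]≈0)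
                  (F.trans (κ-+ 1# _)
                           (F.+-congˡ (F.trans (κ-cong (sym (·-*-assocʳ t x y))) (κ-· t (x * y)))))))
          where
          κ[x+ty]≈0 : κ (x + t · y) F.≈ F.0#
          κ[x+ty]≈0 = F.trans (κ-+ x (t · y)) (F.trans (F.+-cong κx≈0 (F.trans (κ-· t y) (F.*-congˡ κy≈0)))
                                                       (F.trans (F.+-identityˡ _) (F.zeroʳ t)))

      -- κ y ≈ 0 restated as an equation in A: IsSimple only speaks about ideals of level a ⊔ ℓa,
      -- which need not bound ℓ.
      Null : Carrier → Set ℓa
      Null y = κ y · 1# ≈ 0#

      κ≈0⇒null : ∀ {y} → κ y F.≈ F.0# → Null y
      κ≈0⇒null κy≈0 = trans (·-cong κy≈0 refl) (·-zeroˡ 1#)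

      null⇒κ≈0 : ∀ {y} → Null y → κ y F.≈ F.0#
      null⇒κ≈0 = k·1≈0⇒k≈0 1≉0

      null-cong : ∀ {x y} → x ≈ y → Null x → Null y
      null-cong x≈y = κ≈0⇒null ∘ F.trans (κ-cong (sym x≈y)) ∘ null⇒κ≈0

      Sandwich : Carrier → Pred Carrier (a ⊔ ℓa)
      Sandwich x w = ∀ a b → Null (x * (a * (w * (b * x))))

      sandwich-ideal : ∀ x → IsIdeal A (Sandwich x)
      sandwich-ideal x = record
        { resp       = λ w≈w′ w∈ a b → null-cong (*-congˡ (*-congˡ (*-congʳ w≈w′))) (w∈ a b)
        ; zero∈      = λ a b → κ≈0⇒null (F.trans (κ-cong (trans (*-congˡ (trans (*-congˡ (zeroˡ _)) (zeroʳ a))) (zeroʳ x))) κ-0)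
        ; +-closed   = λ {w} {w′} w∈ w′∈ a b → κ≈0⇒null (F.trans
            (κ-cong (trans (*-congˡ (trans (*-congˡ (distribʳ _ w w′)) (distribˡ a _ _))) (distribˡ x _ _)))
            (F.trans (κ-+ _ _) (F.trans (F.+-cong (null⇒κ≈0 (w∈ a b)) (null⇒κ≈0 (w′∈ a b))) (F.+-identityʳ F.0#))))
        ; neg-closed = λ {w} w∈ a b → κ≈0⇒null (F.trans
            (κ-cong (trans (*-congˡ (trans (*-congˡ (sym (-‿distribˡ-* w _))) (sym (-‿distribʳ-* a _)))) (sym (-‿distribʳ-* x _))))
            (F.trans (κ-neg _) (F.trans (F.-‿cong (null⇒κ≈0 (w∈ a b))) -0≈0ᶠ)))
        ; *ˡ-closed  = λ r {w} w∈ a b → null-cong (*-congˡ (trans (*-assoc a r _) (*-congˡ (sym (*-assoc r w _))))) (w∈ (a * r) b)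
        ; *ʳ-closed  = λ r {w} w∈ a b → null-cong (*-congˡ (*-congˡ (trans (*-congˡ (*-assoc r b x)) (sym (*-assoc w r _))))) (w∈ a (r * b))
        }

      sandwich-trivial : ∀ {x w} → Sandwich x w → w ≈ 0# ⊎ κ (x * x) F.≈ F.0#
      sandwich-trivial {x} {w} w∈ with proj₂ simple (Sandwich x) (sandwich-ideal x)
      ... | inj₁ only-0 = inj₁ (only-0 w w∈)
      ... | inj₂ all    = inj₂ (null⇒κ≈0 (null-cong x1[1[1x]]≈xx (all 1# 1# 1#)))
        where
        x1[1[1x]]≈xx : x * (1# * (1# * (1# * x))) ≈ x * x
        x1[1[1x]]≈xx = *-congˡ (trans (*-identityˡ _) (trans (*-identityˡ _) (*-identityˡ x)))

      orthogonal-idempotent-κ≈0 : ∀ {e f} → _*_ IdempotentOn e → _*_ IdempotentOn f →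
                                  e * f ≈ 0# → f * e ≈ 0# → ¬ f ≈ 0# → κ e F.≈ F.0#
      orthogonal-idempotent-κ≈0 {e} {f} e²≈e f²≈f ef≈0 fe≈0 f≉0 =
        [ ⊥-elim ∘ f≉0 , F.trans (κ-cong (sym e²≈e)) ]′ (sandwich-trivial f∈Sandwich-e)
        where
        f∈Sandwich-e : Sandwich e f
        f∈Sandwich-e a b = κ≈0⇒null (F.trans (κ-cong split)
          (κ-square-zero-product (square-zero-sandwich a fe≈0) (square-zero-sandwich b ef≈0)))
          where
          split : e * (a * (f * (b * e))) ≈ (e * (a * f)) * (f * (b * e))
          split = begin
            e * (a * (f * (b * e)))          ≈⟨ *-congˡ (*-congˡ (*-congʳ f²≈f)) ⟨
            e * (a * (f * f * (b * e)))      ≈⟨ *-congˡ (*-congˡ (*-assoc f f _)) ⟩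
            e * (a * (f * (f * (b * e))))    ≈⟨ *-congˡ (*-assoc a f _) ⟨
            e * (a * f * (f * (b * e)))      ≈⟨ *-assoc e _ _ ⟨
            e * (a * f) * (f * (b * e))      ∎

      no-nontrivial-idempotent : ∀ {e} → _*_ IdempotentOn e → ¬ e ≈ 0# → ¬ e ≈ 1# → ⊥
      no-nontrivial-idempotent {e} e²≈e e≉0 e≉1 = κ1≉0 (F.trans (κ-cong 1≈e+[1-e]) (F.trans (κ-+ e _)
        (F.trans (F.+-cong (orthogonal-idempotent-κ≈0 e²≈e 1-e-idempotent e[1-e]≈0 [1-e]e≈0 1-e≉0)
                           (orthogonal-idempotent-κ≈0 1-e-idempotent e²≈e [1-e]e≈0 e[1-e]≈0 e≉0))
                 (F.+-identityʳ F.0#))))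
        where
        open Complement e²≈e
        1-e≉0 : ¬ 1# - e ≈ 0#
        1-e≉0 1-e≈0 = e≉1 (sym (x∙y⁻¹≈ε⇒x≈y 1# e 1-e≈0))

      nonunit⇒nilpotent : ∀ {z} → ¬ IsUnit A z → Nilpotent z
      nonunit⇒nilpotent {z} z-nonunit with simple⇒decidable simple (Nilpotent z)
      ... | yes z-nilpotent = z-nilpotent
      ... | no  ¬nilpotent  with fitting-datum fd z
      ...   | j , _ , zg≈gz , zʲ≈zʲ⁺¹g = ⊥-elim (no-nontrivial-idempotent idempotent
                                                    (¬nilpotent ∘ e≈0⇒nilpotent) (z-nonunit ∘ e≈1⇒invertible))
        where open FittingIdempotent {j = j} zg≈gz zʲ≈zʲ⁺¹g

      κ≈0⇒≈0 : ∀ {h} → κ h F.≈ F.0# → h ≈ 0#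
      κ≈0⇒≈0 {h} κh≈0 = [ id , (λ κ11≈0 → ⊥-elim (κ1≉0 (F.trans (κ-cong (sym (*-identityˡ 1#))) κ11≈0))) ]′
                          (sandwich-trivial {1#} h∈Sandwich-1)
        where
        h-nilpotent : Nilpotent h
        h-nilpotent = nonunit⇒nilpotent (λ h-unit → κ-unit h-unit κh≈0)
        ch-nilpotent : ∀ c → Nilpotent (c * h)
        ch-nilpotent c = nonunit⇒nilpotent λ (y , _ , y[ch]≈1) →
          1≉0 (left-invertible-nilpotent⇒1≈0 (trans (*-assoc y c h) y[ch]≈1) h-nilpotent)
        h∈Sandwich-1 : Sandwich 1# h
        h∈Sandwich-1 a b = κ≈0⇒null (F.trans (κ-cong 1[a[h[b1]]]≈[ah]b)
          (κ-nilpotent (nilpotent-swap (nilpotent-resp (*-assoc b a h) (ch-nilpotent (b * a))))))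
          where
          1[a[h[b1]]]≈[ah]b : 1# * (a * (h * (b * 1#))) ≈ a * h * b
          1[a[h[b1]]]≈[ah]b = trans (*-identityˡ _) (trans (*-congˡ (*-congˡ (*-identityʳ b))) (sym (*-assoc a h b)))

  module CodimensionOne {p} {H : Pred Carrier p} (H-subspace : IsSubspace A H) (codim1 : Codim1 A H) where
    open IsSubspace H-subspace renaming (resp to H-resp; +-closed to H-+; ·-closed to H-·)

    v : Carrier
    v = proj₁ codim1

    κ : Carrier → F.Carrier
    κ x = proj₁ (proj₂ (proj₂ codim1) x)

    x-κx·v∈H : ∀ x → H (x - κ x · v)
    x-κx·v∈H x = proj₂ (proj₂ (proj₂ codim1) x)

    H-neg : ∀ {x} → H x → H (- x)
    H-neg {x} x∈H = H-resp (trans (·-negˡ F.1# x) (-‿cong (·-identity x))) (H-· (F.- F.1#) x∈H)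

    κ-unique : ∀ {x k} → H (x - k · v) → κ x F.≈ k
    κ-unique {x} {k} x-k·v∈H = x∙y⁻¹≈ε⇒x≈yᶠ (κ x) k
      (proj₁ (proj₂ codim1) _ (H-resp difference (H-+ x-k·v∈H (H-neg (x-κx·v∈H x)))))
      where
      difference : (x - k · v) - (x - κ x · v) ≈ (κ x F.- k) · v
      difference = begin
        (x - k · v) - (x - κ x · v)   ≈⟨ [x-y]-[x-z]≈z-y x _ _ ⟩
        κ x · v - k · v               ≈⟨ +-congˡ (·-negˡ k v) ⟨
        κ x · v + (F.- k) · v         ≈⟨ ·-distribʳ (κ x) (F.- k) v ⟨
        (κ x F.- k) · v               ∎

    κ-cong : ∀ {x y} → x ≈ y → κ x F.≈ κ y
    κ-cong {x} x≈y = F.sym (κ-unique (H-resp (+-congʳ x≈y) (x-κx·v∈H x)))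

    κ-+ : ∀ x y → κ (x + y) F.≈ κ x F.+ κ y
    κ-+ x y = κ-unique (H-resp sum (H-+ (x-κx·v∈H x) (x-κx·v∈H y)))
      where
      sum : (x - κ x · v) + (y - κ y · v) ≈ (x + y) - (κ x F.+ κ y) · v
      sum = trans ([x-y]+[z-w]≈[x+z]-[y+w] x _ y _) (+-congˡ (-‿cong (sym (·-distribʳ (κ x) (κ y) v))))

    κ-· : ∀ k x → κ (k · x) F.≈ k F.* κ x
    κ-· k x = κ-unique (H-resp scaled (H-· k (x-κx·v∈H x)))
      where
      scaled : k · (x - κ x · v) ≈ k · x - (k F.* κ x) · v
      scaled = begin
        k · (x - κ x · v)          ≈⟨ ·-distribˡ k x _ ⟩
        k · x + k · - (κ x · v)    ≈⟨ +-congˡ (·-negʳ k _) ⟩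
        k · x - k · (κ x · v)      ≈⟨ +-congˡ (-‿cong (·-assoc k (κ x) v)) ⟨
        k · x - (k F.* κ x) · v    ∎

    H⇒κ≈0 : ∀ {x} → H x → κ x F.≈ F.0#
    H⇒κ≈0 x∈H = κ-unique (H-resp (sym (y≈0⇒x-y≈x (·-zeroˡ v))) x∈H)

    κ≈0⇒H : ∀ {x} → κ x F.≈ F.0# → H x
    κ≈0⇒H {x} κx≈0 = H-resp (y≈0⇒x-y≈x (trans (·-cong κx≈0 refl) (·-zeroˡ v))) (x-κx·v∈H x)

lemma7 : ∀ {c ℓ a ℓa p : Level} (F : Field c ℓ) (A : Algebra F a ℓa) →
         FiniteDimensional A → IsSimple A →
         (H : Pred (Algebra.Carrier A) p) → IsSubspace A H → Codim1 A H →
         (∀ x → H x → ¬ IsUnit A x) →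
         IsoToField A × (∀ x → (H x → Algebra._≈_ A x (Algebra.0# A)) × (Algebra._≈_ A x (Algebra.0# A) → H x))
lemma7 F A fd simple H H-subspace codim1 H-nonunits =
  isoToField , λ x → κ≈0⇒≈0 ∘ H⇒κ≈0 , λ x≈0 → IsSubspace.resp H-subspace (sym x≈0) (IsSubspace.zero∈ H-subspace)
  where
  open Algebra A using (sym)
  open AlgebraTheory A
  open CodimensionOne H-subspace codim1
  open LinearFunctional κ κ-cong κ-+ κ-·
  open UnitDetecting simple fd (λ {u} u-unit κu≈0 → H-nonunits u (κ≈0⇒H κu≈0) u-unit)
  open TrivialKernel κ≈0⇒≈0 κ1≉0
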